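{- Let $n,t,k$ be integers with $n\geq 2t\geq 2$ and $k\geq 2$. Then $P_k(n,t)\leq P_k(t)A_k(n-2t,0^t)$.
   Context: Words are over $\Sigma_k=\{0,1,\ldots,k-1\}$. A word $u$ is a border of $w$ if it is a non-empty proper prefix and proper suffix of $w$. A word $w$ is closed by $u$ if $u$ is a border of $w$ and $u$ occurs exactly twice in $w$ as a factor. A word $w$ is privileged if $|w|\leq 1$ or $w$ is closed by some privileged word (recursive definition). $P_k(m)$ is the number of length-$m$ privileged words over $\Sigma_k$, and $P_k(n,t)$ is the number of length-$n$ privileged words over $\Sigma_k$ that are closed by a privileged word of length $t$. $A_k(m,v)$ is the number of length-$m$ words over $\Sigma_k$ not containing $v$ as a factor; $0^t$ is the word of $t$ zeros. -}

module Defs where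

open import Data.Nat using (ℕ; zero; suc; _+_; _∸_; _≤ᵇ_; _≡ᵇ_)
open import Data.Bool using (Bool; true; false; _∧_; _∨_; not; if_then_else_)
open import Data.Fin using (Fin) renaming (zero to fzero)
import Data.Fin as Fin
open import Data.List using (List; []; _∷_; length; take; drop; map; concatMap; filter; replicate; reverse; upTo)
open import Data.Bool.ListAction using (any)
open import Data.List.Properties using (≡-dec)
open import Relation.Nullary using (does)

Word : ℕ → Set
Word k = List (Fin k)

_==_ : {k : ℕ} → Word k → Word k → Bool
u == v = does (≡-dec Fin._≟_ u v)

isPrefix : {k : ℕ} → Word k → Word k → Bool
isPrefix u w = (length u ≤ᵇ length w) ∧ (take (length u) w == u)

isSuffix : {k : ℕ} → Word k → Word k → Bool
isSuffix u w = isPrefix (reverse u) (reverse w)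

occ : {k : ℕ} → Word k → Word k → ℕ
occ u [] = if isPrefix u [] then 1 else 0
occ u (a ∷ w) = (if isPrefix u (a ∷ w) then 1 else 0) + occ u w

isFactor : {k : ℕ} → Word k → Word k → Bool
isFactor u w = not (occ u w ≡ᵇ 0)

isBorder : {k : ℕ} → Word k → Word k → Bool
isBorder u w = not (length u ≡ᵇ 0) ∧ not (length u ≡ᵇ length w)
             ∧ (length u ≤ᵇ length w) ∧ isPrefix u w ∧ isSuffix u w

closedBy : {k : ℕ} → Word k → Word k → Bool
closedBy u w = isBorder u w ∧ (occ u w ≡ᵇ 2)

-- privileged, with fuel (fuel ≥ |w| makes it exact).
-- A border of w of length t is necessarily  take t w, so "closed by some
-- privileged word" = some t < |w| such that w is closed by take t w and
-- take t w is privileged.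
privF : {k : ℕ} → ℕ → Word k → Bool
privF zero w = length w ≤ᵇ 1
privF (suc f) w = (length w ≤ᵇ 1)
  ∨ any (λ t → closedBy (take t w) w ∧ privF f (take t w)) (upTo (length w))

isPrivileged : {k : ℕ} → Word k → Bool
isPrivileged w = privF (length w) w

words : (k m : ℕ) → List (Word k)
words k zero = [] ∷ []
words k (suc m) = concatMap (λ a → map (a ∷_) (words k m)) (Data.List.allFin k)

count : {k : ℕ} → (Word k → Bool) → List (Word k) → ℕ
count p ws = length (filter (λ w → Data.Bool.T? (p w)) ws)

P : (k m : ℕ) → ℕ
P k m = count isPrivileged (words k m)

P₂ : (k n t : ℕ) → ℕ
P₂ k n t = count (λ w → isPrivileged w
                 ∧ any (λ u → (length u ≡ᵇ t) ∧ closedBy u w ∧ isPrivileged u)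
                       (Data.List.inits w)) (words k n)

A : (k m : ℕ) → Word k → ℕ
A k m v = count (λ w → not (isFactor v w)) (words k m)

-- the word 0^t over Σ_k (k ≥ 1; for k = 0 the alphabet is empty and this
-- default value is never used, since the theorem assumes k ≥ 2)
zeros : (k t : ℕ) → Word k
zeros zero t = []
zeros (suc k) t = replicate t fzero

-- If w = u x v with |u| = |v| = t is closed by a privileged word of length t, that word is u,
-- u is privileged, v = u, and u occurs in x u only as its suffix. Build such an x from right
-- to left, tracking the proper suffix p of u that the part already read begins with: one
-- letter extends p, and each of the other k − 1 letters leaves a state no better than p = [].
-- The resulting recurrence zeroRunFree depends only on |p|, and for u = 0ᵗ it bounds from
-- below the number of x for which x 0ʲ has no factor 0ᵗ; for j = 0 that number is A_k(m, 0ᵗ).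

module Submission where

open import Defs
open import Data.Nat using (ℕ; _≤_; _*_; _∸_)
open import Data.Nat using (zero; suc; _+_; _<_; z≤n; s≤s; _≤ᵇ_; _≡ᵇ_; _<ᵇ_)
open import Data.Nat.Properties
open import Data.Nat.Tactic.RingSolver using (solve-∀)
open import Data.Bool using (Bool; true; false; T; _∧_; not; if_then_else_)
open import Data.Bool.Properties using (T-∧; T-≡; if-cong; not-involutive)
open import Data.Bool.ListAction using (any)
open import Data.Fin using (Fin) renaming (zero to fzero; suc to fsuc)
import Data.Fin.Properties as Fin
open import Data.List using (List; []; _∷_; [_]; _++_; _∷ʳ_; length; map; concatMap; replicate; reverse; take; drop; allFin; inits; _∷ʳ′_; initLast)
open import Data.List.Properties using (≡-dec; map-tabulate; length-replicate; ++-assoc; ++-identityʳ; ++-cancelˡ; take++drop≡id; length-++; reverse-involutive; reverse-++; ∷-injectiveˡ; ∷-injectiveʳ)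
open import Data.List.Relation.Unary.Any using (Any; here; there)
open import Data.List.Relation.Unary.Any.Properties using (any⁻; map⁻)
open import Data.Product using (∃-syntax; ∃₂; _×_; _,_; proj₂)
open import Function using (_∘_; Equivalence)
open import Relation.Nullary using (¬_; does; contradiction)
open import Relation.Nullary.Decidable using (yes; no; dec-true; dec-false)
open import Relation.Binary.PropositionalEquality hiding ([_])

𝟙 : Bool → ℕ
𝟙 true  = 1
𝟙 false = 0

𝟙≤1 : ∀ b → 𝟙 b ≤ 1
𝟙≤1 true  = ≤-refl
𝟙≤1 false = z≤n

𝟙-true : ∀ {b} → T b → 𝟙 b ≡ 1
𝟙-true {true} _ = refl

𝟙-false : ∀ {b} → ¬ T b → 𝟙 b ≡ 0
𝟙-false {true}  ¬b = contradiction _ ¬b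
𝟙-false {false} _  = refl

𝟙-mono : ∀ {b c} → (T b → T c) → 𝟙 b ≤ 𝟙 c
𝟙-mono {false}         _   = z≤n
𝟙-mono {true}  {true}  _   = ≤-refl
𝟙-mono {true}  {false} b⇒c = contradiction (b⇒c _) λ ()

T-∧ʳ : ∀ x {y} → T (x ∧ y) → T y
T-∧ʳ true h = h

∑ : {A : Set} → List A → (A → ℕ) → ℕ
∑ []       f = 0
∑ (x ∷ xs) f = f x + ∑ xs f

infix 5 ∑
syntax ∑ xs (λ x → e) = ∑[ x ∈ xs ] e

module _ {A : Set} where

  ∑-++ : (xs ys : List A) (f : A → ℕ) → ∑ (xs ++ ys) f ≡ ∑ xs f + ∑ ys f
  ∑-++ []       ys f = refl
  ∑-++ (x ∷ xs) ys f = trans (cong (f x +_) (∑-++ xs ys f)) (sym (+-assoc (f x) _ _))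

  ∑-cong : (xs : List A) {f g : A → ℕ} → (∀ x → f x ≡ g x) → ∑ xs f ≡ ∑ xs g
  ∑-cong []       _   = refl
  ∑-cong (x ∷ xs) f≗g = cong₂ _+_ (f≗g x) (∑-cong xs f≗g)

  ∑-mono : (xs : List A) {f g : A → ℕ} → (∀ x → f x ≤ g x) → ∑ xs f ≤ ∑ xs g
  ∑-mono []       _   = z≤n
  ∑-mono (x ∷ xs) f≤g = +-mono-≤ (f≤g x) (∑-mono xs f≤g)

  ∑-zero : (xs : List A) → ∑[ _ ∈ xs ] 0 ≡ 0
  ∑-zero []       = refl
  ∑-zero (_ ∷ xs) = ∑-zero xs

  ∑-distrib-+ : (xs : List A) (f g : A → ℕ) → ∑[ x ∈ xs ] (f x + g x) ≡ ∑ xs f + ∑ xs g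
  ∑-distrib-+ []       f g = refl
  ∑-distrib-+ (x ∷ xs) f g =
    trans (cong (f x + g x +_) (∑-distrib-+ xs f g)) (interchange (f x) (g x) (∑ xs f) (∑ xs g))
    where
    interchange : ∀ a b c d → a + b + (c + d) ≡ a + c + (b + d)
    interchange = solve-∀

  ∑-distribʳ-* : (xs : List A) (f : A → ℕ) (c : ℕ) → ∑[ x ∈ xs ] (f x * c) ≡ ∑ xs f * c
  ∑-distribʳ-* []       f c = refl
  ∑-distribʳ-* (x ∷ xs) f c =
    trans (cong (f x * c +_) (∑-distribʳ-* xs f c)) (sym (*-distribʳ-+ c (f x) (∑ xs f)))

  ∑-𝟙-∧ : (xs : List A) (b : Bool) (p : A → Bool) → ∑[ x ∈ xs ] 𝟙 (b ∧ p x) ≡ 𝟙 b * (∑[ x ∈ xs ] 𝟙 (p x))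
  ∑-𝟙-∧ xs true  p = sym (+-identityʳ _)
  ∑-𝟙-∧ xs false p = ∑-zero xs

module _ {A B : Set} where

  ∑-map : (g : A → B) (xs : List A) (f : B → ℕ) → ∑ (map g xs) f ≡ ∑[ x ∈ xs ] f (g x)
  ∑-map g []       f = refl
  ∑-map g (x ∷ xs) f = cong (f (g x) +_) (∑-map g xs f)

  ∑-concatMap : (h : A → List B) (xs : List A) (f : B → ℕ) →
                ∑ (concatMap h xs) f ≡ ∑[ x ∈ xs ] ∑ (h x) f
  ∑-concatMap h []       f = refl
  ∑-concatMap h (x ∷ xs) f =
    trans (∑-++ (h x) (concatMap h xs) f) (cong (∑ (h x) f +_) (∑-concatMap h xs f))

  ∑-comm : (xs : List A) (ys : List B) (F : A → B → ℕ) →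
           ∑[ x ∈ xs ] ∑[ y ∈ ys ] F x y ≡ ∑[ y ∈ ys ] ∑[ x ∈ xs ] F x y
  ∑-comm []       ys F = sym (∑-zero ys)
  ∑-comm (x ∷ xs) ys F =
    trans (cong (∑ ys (F x) +_) (∑-comm xs ys F))
          (sym (∑-distrib-+ ys (F x) (λ y → ∑[ x ∈ xs ] F x y)))

count≡∑ : ∀ {k} (p : Word k → Bool) (ws : List (Word k)) → count p ws ≡ ∑[ w ∈ ws ] 𝟙 (p w)
count≡∑ p []       = refl
count≡∑ p (w ∷ ws) with p w
... | true  = cong suc (count≡∑ p ws)
... | false = count≡∑ p ws

∑-allFin-suc : ∀ k (f : Fin (suc k) → ℕ) → ∑ (allFin (suc k)) f ≡ f fzero + ∑ (allFin k) (f ∘ fsuc)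
∑-allFin-suc k f =
  cong (f fzero +_) (trans (cong (λ as → ∑ as f) (sym (map-tabulate (λ a → a) fsuc)))
                           (∑-map fsuc (allFin k) f))

∑-allFin-const : ∀ k c → ∑[ _ ∈ allFin k ] c ≡ k * c
∑-allFin-const zero    c = refl
∑-allFin-const (suc k) c = trans (∑-allFin-suc k (λ _ → c)) (cong (c +_) (∑-allFin-const k c))

∑-allFin-≤ : ∀ k (f : Fin k → ℕ) b {h c} → f b ≤ h → (∀ a → a ≢ b → f a ≤ c) →
             ∑ (allFin k) f ≤ h + (k ∸ 1) * c
∑-allFin-≤ (suc k) f fzero {h} {c} fb≤h fa≤c = begin
  ∑ (allFin (suc k)) f                ≡⟨ ∑-allFin-suc k f ⟩
  f fzero + ∑ (allFin k) (f ∘ fsuc)   ≤⟨ +-mono-≤ fb≤h (∑-mono (allFin k) (λ a → fa≤c (fsuc a) (λ ()))) ⟩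
  h + (∑[ _ ∈ allFin k ] c)            ≡⟨ cong (h +_) (∑-allFin-const k c) ⟩
  h + k * c                           ∎
  where open ≤-Reasoning
∑-allFin-≤ (suc (suc k)) f (fsuc b) {h} {c} fb≤h fa≤c = begin
  ∑ (allFin (suc (suc k))) f                   ≡⟨ ∑-allFin-suc (suc k) f ⟩
  f fzero + ∑ (allFin (suc k)) (f ∘ fsuc)      ≤⟨ +-mono-≤ (fa≤c fzero (λ ())) (∑-allFin-≤ (suc k) (f ∘ fsuc) b fb≤h
                                                     (λ a a≢b → fa≤c (fsuc a) (a≢b ∘ Fin.suc-injective))) ⟩
  c + (h + k * c)                              ≡⟨ left-comm c h (k * c) ⟩
  h + (c + k * c)                              ∎
  where
  open ≤-Reasoning
  left-comm : ∀ x y z → x + (y + z) ≡ y + (x + z)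
  left-comm = solve-∀

∑-allFin-≥ : ∀ k (f : Fin (suc k) → ℕ) {h c} → h ≤ f fzero → (∀ a → c ≤ f (fsuc a)) →
             h + k * c ≤ ∑ (allFin (suc k)) f
∑-allFin-≥ k f {h} {c} h≤f0 c≤fa = begin
  h + k * c                           ≡⟨ cong (h +_) (sym (∑-allFin-const k c)) ⟩
  h + (∑[ _ ∈ allFin k ] c)            ≤⟨ +-mono-≤ h≤f0 (∑-mono (allFin k) c≤fa) ⟩
  f fzero + ∑ (allFin k) (f ∘ fsuc)   ≡⟨ sym (∑-allFin-suc k f) ⟩
  ∑ (allFin (suc k)) f                ∎
  where open ≤-Reasoning

module _ (k : ℕ) where

  ∑-words-suc : ∀ m (f : Word k → ℕ) →
                ∑ (words k (suc m)) f ≡ ∑[ a ∈ allFin k ] ∑[ x ∈ words k m ] f (a ∷ x)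
  ∑-words-suc m f = trans (∑-concatMap (λ a → map (a ∷_) (words k m)) (allFin k) f)
                          (∑-cong (allFin k) (λ a → ∑-map (a ∷_) (words k m) f))

  ∑-words-∷ʳ : ∀ m (f : Word k → ℕ) →
               ∑ (words k (suc m)) f ≡ ∑[ a ∈ allFin k ] ∑[ x ∈ words k m ] f (x ∷ʳ a)
  ∑-words-∷ʳ zero    f = ∑-words-suc zero f
  ∑-words-∷ʳ (suc m) f = begin
    ∑ (words k (suc (suc m))) f
      ≡⟨ ∑-words-suc (suc m) f ⟩
    ∑[ a ∈ allFin k ] ∑[ x ∈ words k (suc m) ] f (a ∷ x)
      ≡⟨ ∑-cong (allFin k) (λ a → ∑-words-∷ʳ m (λ x → f (a ∷ x))) ⟩
    ∑[ a ∈ allFin k ] ∑[ b ∈ allFin k ] ∑[ y ∈ words k m ] f (a ∷ y ∷ʳ b)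
      ≡⟨ ∑-comm (allFin k) (allFin k) _ ⟩
    ∑[ b ∈ allFin k ] ∑[ a ∈ allFin k ] ∑[ y ∈ words k m ] f (a ∷ y ∷ʳ b)
      ≡⟨ ∑-cong (allFin k) (λ b → sym (∑-words-suc m (λ x → f (x ∷ʳ b)))) ⟩
    ∑[ b ∈ allFin k ] ∑[ x ∈ words k (suc m) ] f (x ∷ʳ b)
      ∎
    where open ≡-Reasoning

  ∑-words-++ : ∀ m n (f : Word k → ℕ) →
               ∑ (words k (m + n)) f ≡ ∑[ x ∈ words k m ] ∑[ y ∈ words k n ] f (x ++ y)
  ∑-words-++ zero    n f = sym (+-identityʳ _)
  ∑-words-++ (suc m) n f = begin
    ∑ (words k (suc m + n)) f
      ≡⟨ ∑-words-suc (m + n) f ⟩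
    ∑[ a ∈ allFin k ] ∑[ x ∈ words k (m + n) ] f (a ∷ x)
      ≡⟨ ∑-cong (allFin k) (λ a → ∑-words-++ m n (λ x → f (a ∷ x))) ⟩
    ∑[ a ∈ allFin k ] ∑[ x ∈ words k m ] ∑[ y ∈ words k n ] f (a ∷ x ++ y)
      ≡⟨ sym (∑-words-suc m (λ x → ∑[ y ∈ words k n ] f (x ++ y))) ⟩
    ∑[ x ∈ words k (suc m) ] ∑[ y ∈ words k n ] f (x ++ y)
      ∎
    where open ≡-Reasoning

  ∑-words-mono : ∀ m {f g : Word k → ℕ} → (∀ x → length x ≡ m → f x ≤ g x) →
                 ∑ (words k m) f ≤ ∑ (words k m) g
  ∑-words-mono zero    f≤g = +-mono-≤ (f≤g [] refl) z≤n
  ∑-words-mono (suc m) {f} {g} f≤g rewrite ∑-words-suc m f | ∑-words-suc m g =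
    ∑-mono (allFin k) (λ a → ∑-words-mono m (λ x ∣x∣≡m → f≤g (a ∷ x) (cong suc ∣x∣≡m)))

  ∑-words-==-≤1 : ∀ m (u : Word k) → ∑[ v ∈ words k m ] 𝟙 (v == u) ≤ 1
  ∑-words-==-≤1 zero    u       = ≤-trans (≤-reflexive (+-identityʳ _)) (𝟙≤1 _)
  ∑-words-==-≤1 (suc m) []      rewrite ∑-words-suc m (λ v → 𝟙 (v == [])) =
    ≤-trans (≤-reflexive (trans (∑-cong (allFin k) (λ _ → ∑-zero (words k m))) (∑-zero (allFin k)))) z≤n
  ∑-words-==-≤1 (suc m) (b ∷ u) rewrite ∑-words-suc m (λ v → 𝟙 (v == (b ∷ u))) =
    ≤-trans (∑-allFin-≤ k _ b at-b off-b) (≤-reflexive (cong suc (*-zeroʳ (k ∸ 1))))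
    where
    at-b : ∑[ x ∈ words k m ] 𝟙 (does (b Fin.≟ b) ∧ (x == u)) ≤ 1
    at-b = ≤-trans (∑-mono (words k m) (λ x → 𝟙-mono (proj₂ ∘ Equivalence.to T-∧)))
                   (∑-words-==-≤1 m u)
    off-b : ∀ a → a ≢ b → ∑[ x ∈ words k m ] 𝟙 (does (a Fin.≟ b) ∧ (x == u)) ≤ 0
    off-b a a≢b rewrite dec-false (a Fin.≟ b) a≢b = ≤-reflexive (∑-zero (words k m))

module _ {A : Set} where

  take-length-++ : (u s : List A) → take (length u) (u ++ s) ≡ u
  take-length-++ []      s = refl
  take-length-++ (x ∷ u) s = cong (x ∷_) (take-length-++ u s)

  ++-injectiveˡ : (a b c d : List A) → length a ≡ length c → a ++ b ≡ c ++ d → a ≡ c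
  ++-injectiveˡ a b c d ∣a∣≡∣c∣ eq = begin
    a                         ≡⟨ sym (take-length-++ a b) ⟩
    take (length a) (a ++ b)  ≡⟨ cong₂ take ∣a∣≡∣c∣ eq ⟩
    take (length c) (c ++ d)  ≡⟨ take-length-++ c d ⟩
    c                         ∎
    where open ≡-Reasoning

  ++-injectiveʳ : (a b c d : List A) → length b ≡ length d → a ++ b ≡ c ++ d → b ≡ d
  ++-injectiveʳ a b c d ∣b∣≡∣d∣ eq =
    ++-cancelˡ c b d (subst (λ a → a ++ b ≡ c ++ d) (++-injectiveˡ a b c d ∣a∣≡∣c∣ eq) eq)
    where
    ∣a∣≡∣c∣ : length a ≡ length c
    ∣a∣≡∣c∣ = +-cancelʳ-≡ (length b) (length a) (length c) (begin
      length a + length b  ≡⟨ sym (length-++ a) ⟩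
      length (a ++ b)      ≡⟨ cong length eq ⟩
      length (c ++ d)      ≡⟨ length-++ c ⟩
      length c + length d  ≡⟨ cong (length c +_) (sym ∣b∣≡∣d∣) ⟩
      length c + length b  ∎)
      where open ≡-Reasoning

  replicate-prefix-++ˡ : ∀ n {c a : A} (y w s : List A) → a ≢ c →
                         y ++ a ∷ w ≡ replicate n c ++ s → ∃[ s′ ] y ≡ replicate n c ++ s′
  replicate-prefix-++ˡ zero    y       w s a≢c eq = y , refl
  replicate-prefix-++ˡ (suc n) []      w s a≢c eq = contradiction (∷-injectiveˡ eq) a≢c
  replicate-prefix-++ˡ (suc n) (b ∷ y) w s a≢c eq
    with replicate-prefix-++ˡ n y w s a≢c (∷-injectiveʳ eq)
  ... | s′ , refl = s′ , cong (_∷ _) (∷-injectiveˡ eq)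

  Any-inits⇒ : {P : List A → Set} (w : List A) → Any P (inits w) → ∃₂ λ u s → w ≡ u ++ s × P u
  Any-inits⇒ w       (here pu) = [] , w , refl , pu
  Any-inits⇒ (a ∷ w) (there h) with Any-inits⇒ w (map⁻ h)
  ... | u , s , refl , pu = a ∷ u , s , refl , pu

module _ {k : ℕ} where

  ==⇒≡ : {u v : Word k} → T (u == v) → u ≡ v
  ==⇒≡ {u} {v} h with ≡-dec Fin._≟_ u v | h
  ... | yes u≡v | _  = u≡v
  ... | no  _   | ()

  ≡⇒== : {u v : Word k} → u ≡ v → T (u == v)
  ≡⇒== {u} {v} u≡v = subst T (sym (dec-true (≡-dec Fin._≟_ u v) u≡v)) _

  isPrefix-++ : (u s : Word k) → T (isPrefix u (u ++ s))
  isPrefix-++ u s = Equivalence.from T-∧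
    ( ≤⇒≤ᵇ (≤-trans (m≤m+n (length u) (length s)) (≤-reflexive (sym (length-++ u))))
    , ≡⇒== (take-length-++ u s) )

  isPrefix⇒ : (u w : Word k) → T (isPrefix u w) → ∃[ s ] w ≡ u ++ s
  isPrefix⇒ u w h = drop (length u) w , (begin
    w                                       ≡⟨ sym (take++drop≡id (length u) w) ⟩
    take (length u) w ++ drop (length u) w  ≡⟨ cong (_++ drop (length u) w) (==⇒≡ (T-∧ʳ (length u ≤ᵇ length w) h)) ⟩
    u ++ drop (length u) w                  ∎)
    where open ≡-Reasoning

  isSuffix⇒ : (u w : Word k) → T (isSuffix u w) → ∃[ s ] w ≡ s ++ u
  isSuffix⇒ u w h with isPrefix⇒ (reverse u) (reverse w) h
  ... | s , eq = reverse s , (begin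
    w                                  ≡⟨ sym (reverse-involutive w) ⟩
    reverse (reverse w)                ≡⟨ cong reverse eq ⟩
    reverse (reverse u ++ s)           ≡⟨ reverse-++ (reverse u) s ⟩
    reverse s ++ reverse (reverse u)   ≡⟨ cong (reverse s ++_) (reverse-involutive u) ⟩
    reverse s ++ u                     ∎)
    where open ≡-Reasoning

  isPrefix-short : (u w : Word k) → length w < length u → ¬ T (isPrefix u w)
  isPrefix-short u w ∣w∣<∣u∣ h with isPrefix⇒ u w h
  ... | s , refl = <⇒≱ ∣w∣<∣u∣ (≤-trans (m≤m+n (length u) (length s)) (≤-reflexive (sym (length-++ u))))

  occ-∷ : (u : Word k) (a : Fin k) (r : Word k) → occ u (a ∷ r) ≡ 𝟙 (isPrefix u (a ∷ r)) + occ u r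
  occ-∷ u a r with isPrefix u (a ∷ r)
  ... | true  = refl
  ... | false = refl

  occ-∷-prefix : (u : Word k) (a : Fin k) (r : Word k) → T (isPrefix u (a ∷ r)) → occ u (a ∷ r) ≡ suc (occ u r)
  occ-∷-prefix u a r p = trans (occ-∷ u a r) (cong (_+ occ u r) (𝟙-true p))

  occ-∷-¬prefix : (u : Word k) (a : Fin k) (r : Word k) → ¬ T (isPrefix u (a ∷ r)) → occ u (a ∷ r) ≡ occ u r
  occ-∷-¬prefix u a r ¬p = trans (occ-∷ u a r) (cong (_+ occ u r) (𝟙-false ¬p))

  occ-∷≡0 : (u : Word k) (a : Fin k) (r : Word k) → occ u (a ∷ r) ≡ 0 → ¬ T (isPrefix u (a ∷ r)) × occ u r ≡ 0
  occ-∷≡0 u a r eq = ¬p , m+n≡0⇒n≡0 (𝟙 (isPrefix u (a ∷ r))) (trans (sym (occ-∷ u a r)) eq)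
    where
    ¬p : ¬ T (isPrefix u (a ∷ r))
    ¬p p = 1+n≢0 (trans (sym (occ-∷-prefix u a r p)) eq)

  occ-short : (u w : Word k) → length w < length u → occ u w ≡ 0
  occ-short u [] ∣w∣<∣u∣ with isPrefix u [] in eq
  ... | true  = contradiction (subst T (sym eq) _) (isPrefix-short u [] ∣w∣<∣u∣)
  ... | false = refl
  occ-short u (a ∷ w) ∣w∣<∣u∣ = begin
    occ u (a ∷ w)  ≡⟨ occ-∷-¬prefix u a w (isPrefix-short u (a ∷ w) ∣w∣<∣u∣) ⟩
    occ u w        ≡⟨ occ-short u w (<-trans (n<1+n _) ∣w∣<∣u∣) ⟩
    0              ∎
    where open ≡-Reasoning

  occ-++ˡ : (u l w : Word k) → occ u w ≤ occ u (l ++ w)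
  occ-++ˡ u []      w = ≤-refl
  occ-++ˡ u (a ∷ l) w = ≤-trans (occ-++ˡ u l w) (≤-trans (m≤n+m _ _) (≤-reflexive (sym (occ-∷ u a (l ++ w)))))

  occ-self : (u : Word k) → 1 ≤ length u → occ u u ≡ 1
  occ-self (a ∷ u) _ = begin
    occ (a ∷ u) (a ∷ u)  ≡⟨ occ-∷-prefix (a ∷ u) a u (subst (T ∘ isPrefix (a ∷ u)) (++-identityʳ (a ∷ u)) (isPrefix-++ (a ∷ u) [])) ⟩
    suc (occ (a ∷ u) u)  ≡⟨ cong suc (occ-short (a ∷ u) u (n<1+n _)) ⟩
    1                    ∎
    where open ≡-Reasoning

  occ-++-self : (u : Word k) → 1 ≤ length u → ∀ y → suc (occ u y) ≤ occ u (u ++ y)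
  occ-++-self (a ∷ u) _ y = begin
    suc (occ (a ∷ u) y)              ≤⟨ s≤s (occ-++ˡ (a ∷ u) u y) ⟩
    suc (occ (a ∷ u) (u ++ y))       ≡⟨ sym (occ-∷-prefix (a ∷ u) a (u ++ y) (isPrefix-++ (a ∷ u) y)) ⟩
    occ (a ∷ u) (a ∷ u ++ y)         ∎
    where open ≤-Reasoning

-- Prepending letters without creating an occurrence

-- For j < t, the number of words x of length m such that x 0ʲ has no factor 0ᵗ.
zeroRunFree : (k t j m : ℕ) → ℕ
zeroRunFree k t j zero    = 1
zeroRunFree k t j (suc m) = (if suc j <ᵇ t then zeroRunFree k t (suc j) m else 0) + (k ∸ 1) * zeroRunFree k t 0 m

noNewOcc : {k : ℕ} → Word k → Word k → Word k → Bool
noNewOcc u r x = occ u (x ++ r) ≤ᵇ occ u r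

#noNewOcc : {k : ℕ} → Word k → Word k → ℕ → ℕ
#noNewOcc {k} u r m = ∑[ x ∈ words k m ] 𝟙 (noNewOcc u r x)

module _ {k : ℕ} (u : Word k) where

  noNewOcc-∷ʳ : ∀ r a x → T (noNewOcc u r (x ∷ʳ a)) → T (noNewOcc u (a ∷ r) x)
  noNewOcc-∷ʳ r a x h = ≤⇒≤ᵇ (begin
    occ u (x ++ a ∷ r)     ≡⟨ cong (occ u) (sym (++-assoc x [ a ] r)) ⟩
    occ u (x ∷ʳ a ++ r)    ≤⟨ ≤ᵇ⇒≤ _ _ h ⟩
    occ u r                ≤⟨ occ-++ˡ u [ a ] r ⟩
    occ u (a ∷ r)          ∎)
    where open ≤-Reasoning

  noNewOcc-completing : ∀ r a x → T (isPrefix u (a ∷ r)) → ¬ T (noNewOcc u r (x ∷ʳ a))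
  noNewOcc-completing r a x p h = <⇒≱ (begin-strict
    occ u r                <⟨ n<1+n _ ⟩
    suc (occ u r)          ≡⟨ sym (occ-∷-prefix u a r p) ⟩
    occ u (a ∷ r)          ≤⟨ occ-++ˡ u x (a ∷ r) ⟩
    occ u (x ++ a ∷ r)     ≡⟨ cong (occ u) (sym (++-assoc x [ a ] r)) ⟩
    occ u (x ∷ʳ a ++ r)    ∎) (≤ᵇ⇒≤ _ _ h)
    where open ≤-Reasoning

-- u = v c is split as q b p: the word read so far begins with the proper suffix p of u,
-- and only the letter b can extend this partial match.
module _ {k : ℕ} (v : Word k) (c : Fin k) where

  #noNewOcc-≤ : ∀ m q b p s → v ∷ʳ c ≡ q ++ b ∷ p →
                #noNewOcc (v ∷ʳ c) (p ++ s) m ≤ zeroRunFree k (length (v ∷ʳ c)) (length p) m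
  #noNewOcc-≤ zero    q b p s _ = ≤-trans (≤-reflexive (+-identityʳ _)) (𝟙≤1 _)
  #noNewOcc-≤ (suc m) q b p s u≡qbp = begin
    #noNewOcc u r (suc m)
      ≡⟨ ∑-words-∷ʳ k m _ ⟩
    ∑[ a ∈ allFin k ] ∑[ x ∈ words k m ] 𝟙 (noNewOcc u r (x ∷ʳ a))
      ≤⟨ ∑-allFin-≤ k _ b (matching q u≡qbp) (λ a _ → mismatching a) ⟩
    zeroRunFree k (length u) (length p) (suc m)
      ∎
    where
    open ≤-Reasoning
    u r : Word k
    u = v ∷ʳ c
    r = p ++ s

    after : ∀ a → ∑[ x ∈ words k m ] 𝟙 (noNewOcc u r (x ∷ʳ a)) ≤ #noNewOcc u (a ∷ r) m
    after a = ∑-mono (words k m) (λ x → 𝟙-mono (noNewOcc-∷ʳ u r a x))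

    mismatching : ∀ a → ∑[ x ∈ words k m ] 𝟙 (noNewOcc u r (x ∷ʳ a)) ≤ zeroRunFree k (length u) 0 m
    mismatching a = ≤-trans (after a) (#noNewOcc-≤ m v c [] (a ∷ r) refl)

    matching : ∀ q → u ≡ q ++ b ∷ p →
               ∑[ x ∈ words k m ] 𝟙 (noNewOcc u r (x ∷ʳ b))
                 ≤ (if suc (length p) <ᵇ length u then zeroRunFree k (length u) (suc (length p)) m else 0)
    matching q u≡qbp with initLast q
    ... | [] = ≤-trans (≤-reflexive (trans (∑-cong (words k m) killed) (∑-zero (words k m)))) z≤n
      where
      killed : ∀ x → 𝟙 (noNewOcc u r (x ∷ʳ b)) ≡ 0
      killed x = 𝟙-false (noNewOcc-completing u r b x
                   (subst (λ w → T (isPrefix u (w ++ s))) u≡qbp (isPrefix-++ u s)))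
    ... | q′ ∷ʳ′ b′ = begin
      ∑[ x ∈ words k m ] 𝟙 (noNewOcc u r (x ∷ʳ b))
        ≤⟨ after b ⟩
      #noNewOcc u (b ∷ r) m
        ≤⟨ #noNewOcc-≤ m q′ b′ (b ∷ p) s u≡q′b′bp ⟩
      zeroRunFree k (length u) (suc (length p)) m
        ≡⟨ sym (if-cong (Equivalence.to T-≡ (<⇒<ᵇ longer))) ⟩
      (if suc (length p) <ᵇ length u then zeroRunFree k (length u) (suc (length p)) m else 0)
        ∎
      where
      u≡q′b′bp : u ≡ q′ ++ b′ ∷ b ∷ p
      u≡q′b′bp = trans u≡qbp (++-assoc q′ [ b′ ] (b ∷ p))
      longer : suc (length p) < length u
      longer = begin-strict
        suc (length p)                   <⟨ n<1+n _ ⟩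
        length (b′ ∷ b ∷ p)              ≤⟨ m≤n+m _ (length q′) ⟩
        length q′ + length (b′ ∷ b ∷ p)  ≡⟨ sym (length-++ q′) ⟩
        length (q′ ++ b′ ∷ b ∷ p)        ≡⟨ cong length (sym u≡q′b′bp) ⟩
        length u                         ∎

#noNewOcc-self-≤ : ∀ {k} (u : Word k) m → 1 ≤ length u → #noNewOcc u u m ≤ zeroRunFree k (length u) 0 m
#noNewOcc-self-≤ u m 1≤∣u∣ with initLast u
... | []     = contradiction 1≤∣u∣ λ ()
... | v ∷ʳ′ c = #noNewOcc-≤ v c m v c [] (v ∷ʳ c) refl

-- Runs of zeros

module _ {k : ℕ} (v w : Word k) where

  ¬factor⇒occ≡0 : T (not (isFactor v w)) → occ v w ≡ 0
  ¬factor⇒occ≡0 h = ≡ᵇ⇒≡ (occ v w) 0 (subst T (not-involutive _) h)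

  occ≡0⇒¬factor : occ v w ≡ 0 → T (not (isFactor v w))
  occ≡0⇒¬factor h = subst T (sym (not-involutive _)) (≡⇒≡ᵇ (occ v w) 0 h)

module _ {k : ℕ} (c : Fin k) {t : ℕ} (1≤t : 1 ≤ t) where

  private
    run : Word k
    run = replicate t c

  ¬isPrefix-run-++ : ∀ y a w → a ≢ c → ¬ T (isPrefix run y) → ¬ T (isPrefix run (y ++ a ∷ w))
  ¬isPrefix-run-++ y a w a≢c ¬p p with isPrefix⇒ run _ p
  ... | s , eq with replicate-prefix-++ˡ t y w s a≢c eq
  ... | s′ , refl = ¬p (isPrefix-++ run s′)

  occ-run-++-∷ : ∀ x a w → a ≢ c → occ run x ≡ 0 → occ run w ≡ 0 → occ run (x ++ a ∷ w) ≡ 0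
  occ-run-++-∷ []      a w a≢c _ w-free =
    trans (occ-∷-¬prefix run a w (¬isPrefix-run-++ [] a w a≢c ¬isPrefix-run-[])) w-free
    where
    ¬isPrefix-run-[] : ¬ T (isPrefix run [])
    ¬isPrefix-run-[] = isPrefix-short run [] (subst (0 <_) (sym (length-replicate t)) 1≤t)
  occ-run-++-∷ (b ∷ x) a w a≢c bx-free w-free with occ-∷≡0 run b x bx-free
  ... | ¬p , x-free =
    trans (occ-∷-¬prefix run b (x ++ a ∷ w) (¬isPrefix-run-++ (b ∷ x) a w a≢c ¬p))
          (occ-run-++-∷ x a w a≢c x-free w-free)

module _ {k t : ℕ} (1≤t : 1 ≤ t) where

  private
    0^ : ℕ → Word (suc k)
    0^ = zeros (suc k)

    avoids0^t : Word (suc k) → Bool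
    avoids0^t w = not (isFactor (0^ t) w)

    occ-short-run : ∀ j → j < t → occ (0^ t) (0^ j) ≡ 0
    occ-short-run j j<t = occ-short (0^ t) (0^ j)
      (subst₂ _<_ (sym (length-replicate j)) (sym (length-replicate t)) j<t)

  zeroRunFree-≤ : ∀ m j → j < t → zeroRunFree (suc k) t j m ≤ ∑[ x ∈ words (suc k) m ] 𝟙 (avoids0^t (x ++ 0^ j))
  zeroRunFree-≤ zero    j j<t =
    ≤-reflexive (sym (trans (+-identityʳ _) (𝟙-true (occ≡0⇒¬factor (0^ t) (0^ j) (occ-short-run j j<t)))))
  zeroRunFree-≤ (suc m) j j<t = begin
    zeroRunFree (suc k) t j (suc m)
      ≤⟨ ∑-allFin-≥ k _ at-zero at-nonzero ⟩
    ∑[ a ∈ allFin (suc k) ] ∑[ x ∈ words (suc k) m ] 𝟙 (avoids0^t (x ∷ʳ a ++ 0^ j))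
      ≡⟨ sym (∑-words-∷ʳ (suc k) m _) ⟩
    ∑[ x ∈ words (suc k) (suc m) ] 𝟙 (avoids0^t (x ++ 0^ j))
      ∎
    where
    open ≤-Reasoning

    at-zero : (if suc j <ᵇ t then zeroRunFree (suc k) t (suc j) m else 0)
                ≤ ∑[ x ∈ words (suc k) m ] 𝟙 (avoids0^t (x ∷ʳ fzero ++ 0^ j))
    at-zero with suc j <ᵇ t in eq
    ... | false = z≤n
    ... | true  = ≤-trans (zeroRunFree-≤ m (suc j) (<ᵇ⇒< (suc j) t (subst T (sym eq) _)))
                    (≤-reflexive (∑-cong (words (suc k) m)
                      (λ x → cong (𝟙 ∘ avoids0^t) (sym (++-assoc x [ fzero ] (0^ j))))))

    at-nonzero : ∀ a → zeroRunFree (suc k) t 0 m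
                         ≤ ∑[ x ∈ words (suc k) m ] 𝟙 (avoids0^t (x ∷ʳ fsuc a ++ 0^ j))
    at-nonzero a = ≤-trans (zeroRunFree-≤ m 0 1≤t) (∑-mono (words (suc k) m) (λ x → 𝟙-mono (extend x)))
      where
      extend : ∀ x → T (avoids0^t (x ++ [])) → T (avoids0^t (x ∷ʳ fsuc a ++ 0^ j))
      extend x h = occ≡0⇒¬factor (0^ t) (x ∷ʳ fsuc a ++ 0^ j) (begin-equality
        occ (0^ t) (x ∷ʳ fsuc a ++ 0^ j)   ≡⟨ cong (occ (0^ t)) (++-assoc x [ fsuc a ] (0^ j)) ⟩
        occ (0^ t) (x ++ fsuc a ∷ 0^ j)    ≡⟨ occ-run-++-∷ fzero 1≤t x (fsuc a) (0^ j) (λ ())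
                                               (subst (λ w → occ (0^ t) w ≡ 0) (++-identityʳ x) (¬factor⇒occ≡0 (0^ t) (x ++ []) h))
                                               (occ-short-run j j<t) ⟩
        0                                 ∎)

  zeroRunFree-≤-A : ∀ m → zeroRunFree (suc k) t 0 m ≤ A (suc k) m (0^ t)
  zeroRunFree-≤-A m = begin
    zeroRunFree (suc k) t 0 m                           ≤⟨ zeroRunFree-≤ m 0 1≤t ⟩
    ∑[ x ∈ words (suc k) m ] 𝟙 (avoids0^t (x ++ []))   ≡⟨ ∑-cong (words (suc k) m) (λ x → cong (𝟙 ∘ avoids0^t) (++-identityʳ x)) ⟩
    ∑[ x ∈ words (suc k) m ] 𝟙 (avoids0^t x)           ≡⟨ sym (count≡∑ avoids0^t (words (suc k) m)) ⟩
    A (suc k) m (0^ t)                                 ∎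
    where open ≤-Reasoning

-- Words closed by a privileged word

closesPrivileged : ∀ {k} → ℕ → Word k → Word k → Bool
closesPrivileged t w u = (length u ≡ᵇ t) ∧ closedBy u w ∧ isPrivileged u

closedByPrivileged : ∀ {k} → ℕ → Word k → Bool
closedByPrivileged t w = isPrivileged w ∧ any (closesPrivileged t w) (inits w)

module _ {k : ℕ} where

  isBorder⇒isSuffix : (u w : Word k) → T (isBorder u w) → T (isSuffix u w)
  isBorder⇒isSuffix u w =
    T-∧ʳ (isPrefix u w) ∘ T-∧ʳ (length u ≤ᵇ length w) ∘ T-∧ʳ (not (length u ≡ᵇ length w)) ∘ T-∧ʳ (not (length u ≡ᵇ 0))

  closedBy⇒ : (u w : Word k) → T (closedBy u w) → T (isSuffix u w) × occ u w ≡ 2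
  closedBy⇒ u w h with Equivalence.to (T-∧ {isBorder u w}) h
  ... | border , twice = isBorder⇒isSuffix u w border , ≡ᵇ⇒≡ (occ u w) 2 twice

  closedByPrivileged-++ : ∀ t (u y : Word k) → length u ≡ t → T (closedByPrivileged t (u ++ y)) →
                          T (isPrivileged u) × T (closedBy u (u ++ y))
  closedByPrivileged-++ t u y ∣u∣≡t h
    with Any-inits⇒ (u ++ y) (any⁻ (closesPrivileged t (u ++ y)) (inits (u ++ y)) (T-∧ʳ (isPrivileged (u ++ y)) h))
  ... | u′ , s , eq , closes with Equivalence.to (T-∧ {length u′ ≡ᵇ t}) closes
  ... | ∣u′∣≡t , closed∧priv with ++-injectiveˡ u y u′ s (trans ∣u∣≡t (sym (≡ᵇ⇒≡ (length u′) t ∣u′∣≡t))) eq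
  ... | refl with Equivalence.to (T-∧ {closedBy u (u ++ y)}) closed∧priv
  ... | closed , priv = priv , closed

  isSuffix-++-same-length : (u x v : Word k) → length v ≡ length u → T (isSuffix u (u ++ x ++ v)) → v ≡ u
  isSuffix-++-same-length u x v ∣v∣≡∣u∣ suffix with isSuffix⇒ u (u ++ x ++ v) suffix
  ... | s , eq = ++-injectiveʳ (u ++ x) v s u ∣v∣≡∣u∣ (trans (++-assoc u x v) eq)

  closedByPrivileged-decompose : ∀ t (u x v : Word k) → length u ≡ t → length v ≡ t → 1 ≤ t →
                                 T (closedByPrivileged t (u ++ x ++ v)) →
                                 T (isPrivileged u ∧ noNewOcc u u x) × v ≡ u
  closedByPrivileged-decompose t u x v ∣u∣≡t ∣v∣≡t 1≤t h
    with closedByPrivileged-++ t u (x ++ v) ∣u∣≡t h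
  ... | priv , closed with closedBy⇒ u (u ++ x ++ v) closed
  ... | suffix , twice with isSuffix-++-same-length u x v (trans ∣v∣≡t (sym ∣u∣≡t)) suffix
  ... | refl = Equivalence.from T-∧ (priv , ≤⇒≤ᵇ (≤-pred (begin
    suc (occ u (x ++ u))  ≤⟨ occ-++-self u 1≤∣u∣ (x ++ u) ⟩
    occ u (u ++ x ++ u)   ≡⟨ twice ⟩
    2                     ≡⟨ cong suc (sym (occ-self u 1≤∣u∣)) ⟩
    suc (occ u u)         ∎))) , refl
    where
    open ≤-Reasoning
    1≤∣u∣ : 1 ≤ length u
    1≤∣u∣ = subst (1 ≤_) (sym ∣u∣≡t) 1≤t

module _ {k t : ℕ} (1≤t : 1 ≤ t) where

  closedByPrivileged-prefix-≤ : ∀ m (u : Word k) → length u ≡ t →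
    ∑[ x ∈ words k m ] ∑[ v ∈ words k t ] 𝟙 (closedByPrivileged t (u ++ x ++ v))
      ≤ 𝟙 (isPrivileged u) * zeroRunFree k t 0 m
  closedByPrivileged-prefix-≤ m u refl = begin
    ∑[ x ∈ words k m ] ∑[ v ∈ words k t ] 𝟙 (closedByPrivileged t (u ++ x ++ v))
      ≤⟨ ∑-mono (words k m) (λ x → ∑-words-mono k t (λ v ∣v∣≡t → 𝟙-mono (decompose x v ∣v∣≡t))) ⟩
    ∑[ x ∈ words k m ] ∑[ v ∈ words k t ] 𝟙 ((isPrivileged u ∧ noNewOcc u u x) ∧ (v == u))
      ≡⟨ ∑-cong (words k m) (λ x → ∑-𝟙-∧ (words k t) _ (_== u)) ⟩
    ∑[ x ∈ words k m ] 𝟙 (isPrivileged u ∧ noNewOcc u u x) * (∑[ v ∈ words k t ] 𝟙 (v == u))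
      ≤⟨ ∑-mono (words k m) (λ x → *-monoʳ-≤ (𝟙 (isPrivileged u ∧ noNewOcc u u x)) (∑-words-==-≤1 k t u)) ⟩
    ∑[ x ∈ words k m ] 𝟙 (isPrivileged u ∧ noNewOcc u u x) * 1
      ≡⟨ ∑-cong (words k m) (λ x → *-identityʳ _) ⟩
    ∑[ x ∈ words k m ] 𝟙 (isPrivileged u ∧ noNewOcc u u x)
      ≡⟨ ∑-𝟙-∧ (words k m) (isPrivileged u) (noNewOcc u u) ⟩
    𝟙 (isPrivileged u) * #noNewOcc u u m
      ≤⟨ *-monoʳ-≤ (𝟙 (isPrivileged u)) (#noNewOcc-self-≤ u m 1≤t) ⟩
    𝟙 (isPrivileged u) * zeroRunFree k (length u) 0 m
      ∎
    where
    open ≤-Reasoning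
    decompose : ∀ x v → length v ≡ length u →
                T (closedByPrivileged (length u) (u ++ x ++ v)) → T ((isPrivileged u ∧ noNewOcc u u x) ∧ (v == u))
    decompose x v ∣v∣≡∣u∣ h with closedByPrivileged-decompose (length u) u x v refl ∣v∣≡∣u∣ 1≤t h
    ... | priv∧noNew , v≡u = Equivalence.from T-∧ (priv∧noNew , ≡⇒== v≡u)

  P₂-≤ : ∀ m → P₂ k (t + (m + t)) t ≤ P k t * zeroRunFree k t 0 m
  P₂-≤ m = begin
    P₂ k (t + (m + t)) t
      ≡⟨ count≡∑ (closedByPrivileged t) (words k (t + (m + t))) ⟩
    ∑[ w ∈ words k (t + (m + t)) ] 𝟙 (closedByPrivileged t w)
      ≡⟨ ∑-words-++ k t (m + t) _ ⟩
    ∑[ u ∈ words k t ] ∑[ y ∈ words k (m + t) ] 𝟙 (closedByPrivileged t (u ++ y))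
      ≡⟨ ∑-cong (words k t) (λ u → ∑-words-++ k m t _) ⟩
    ∑[ u ∈ words k t ] ∑[ x ∈ words k m ] ∑[ v ∈ words k t ] 𝟙 (closedByPrivileged t (u ++ x ++ v))
      ≤⟨ ∑-words-mono k t (closedByPrivileged-prefix-≤ m) ⟩
    ∑[ u ∈ words k t ] 𝟙 (isPrivileged u) * zeroRunFree k t 0 m
      ≡⟨ ∑-distribʳ-* (words k t) (𝟙 ∘ isPrivileged) _ ⟩
    (∑[ u ∈ words k t ] 𝟙 (isPrivileged u)) * zeroRunFree k t 0 m
      ≡⟨ cong (_* zeroRunFree k t 0 m) (sym (count≡∑ isPrivileged (words k t))) ⟩
    P k t * zeroRunFree k t 0 m
      ∎
    where open ≤-Reasoning

lemma16 : (n t k : ℕ) → 2 * t ≤ n → 1 ≤ t → 2 ≤ k →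
    P₂ k n t ≤ P k t * A k (n ∸ 2 * t) (zeros k t)
lemma16 n t zero    _    _   ()
lemma16 n t (suc k) 2t≤n 1≤t _ = begin
  P₂ (suc k) n t                            ≡⟨ cong (λ n → P₂ (suc k) n t) n≡t+[d+t] ⟩
  P₂ (suc k) (t + (d + t)) t                ≤⟨ P₂-≤ 1≤t d ⟩
  P (suc k) t * zeroRunFree (suc k) t 0 d   ≤⟨ *-monoʳ-≤ (P (suc k) t) (zeroRunFree-≤-A 1≤t d) ⟩
  P (suc k) t * A (suc k) d (zeros (suc k) t) ∎
  where
  open ≤-Reasoning
  d : ℕ
  d = n ∸ 2 * t
  n≡t+[d+t] : n ≡ t + (d + t)
  n≡t+[d+t] = begin-equality
    n              ≡⟨ sym (m+[n∸m]≡n 2t≤n) ⟩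
    2 * t + d      ≡⟨ rearrange t d ⟩
    t + (d + t)    ∎
    where
    rearrange : ∀ t d → 2 * t + d ≡ t + (d + t)
    rearrange = solve-∀
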